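{- For all terms $M, M', N, N'$: if $M\Rrightarrow M'$ and $N\Rrightarrow N'$, then $MN\Rrightarrow M'N'$.
   Context: Terms and values of the call-by-value $\lambda$-calculus are defined by mutual induction from a countably infinite set of variables: values $V ::= x \mid \lambda x.M$ and terms $M,N,L ::= V \mid MN$, up to $\alpha$-conversion, application associating to the left; $\mathrm{fv}(M)$ is the set of free variables and $M\{V/x\}$ capture-avoiding substitution of a value. $^*$ denotes reflexive-transitive closure. In all rules below $m\ge0$ and $V,V'$ range over values. Head $\beta_v$-reduction $\to_{h\beta_v}$: least relation with $(\lambda x.M)V M_1\dots M_m \to_{h\beta_v} M\{V/x\}M_1\dots M_m$, and if $N\to_{h\beta_v}N'$ then $VNM_1\dots M_m\to_{h\beta_v}VN'M_1\dots M_m$. Head $\sigma$-reduction $\to_{h\sigma}$: least relation with $(\lambda x.M)NLM_1\dots M_m\to_{h\sigma}(\lambda x.ML)NM_1\dots M_m$ ($x\notin\mathrm{fv}(L)$), $V((\lambda x.L)N)M_1\dots M_m\to_{h\sigma}(\lambda x.VL)NM_1\dots M_m$ ($x\notin\mathrm{fv}(V)$), and if $N\to_{h\sigma}N'$ then $VNM_1\dots M_m\to_{h\sigma}VN'M_1\dots M_m$. Parallel reduction $\Rightarrow$ is the least relation closed under: ($\beta_v$) if $V\Rightarrow V'$ and $M_i\Rightarrow M_i'$ for $0\le i\le m$ then $(\lambda x.M_0)VM_1\dots M_m\Rightarrow M_0'\{V'/x\}M_1'\dots M_m'$; ($\sigma_1$) if $N\Rightarrow N'$, $L\Rightarrow L'$,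 $M_i\Rightarrow M_i'$ for $0\le i\le m$, and $x\notin\mathrm{fv}(L)$, then $(\lambda x.M_0)NLM_1\dots M_m\Rightarrow(\lambda x.M_0'L')N'M_1'\dots M_m'$; ($\sigma_3$) if $V\Rightarrow V'$, $N\Rightarrow N'$, $L\Rightarrow L'$, $M_i\Rightarrow M_i'$ for $1\le i\le m$, and $x\notin\mathrm{fv}(V)$, then $V((\lambda x.L)N)M_1\dots M_m\Rightarrow(\lambda x.V'L')N'M_1'\dots M_m'$; ($\lambda$) if $M_i\Rightarrow M_i'$ for $0\le i\le m$ then $(\lambda x.M_0)M_1\dots M_m\Rightarrow(\lambda x.M_0')M_1'\dots M_m'$; (var) if $M_i\Rightarrow M_i'$ for $1\le i\le m$ then $xM_1\dots M_m\Rightarrow xM_1'\dots M_m'$. Internal parallel reduction $\Rightarrow_{int}$ is the least relation with: if $N\Rightarrow N'$ then $\lambda x.N\Rightarrow_{int}\lambda x.N'$; $x\Rightarrow_{int}x$; if $V\Rightarrow V'$, $N\Rightarrow_{int}N'$ and $M_i\Rightarrow M_i'$ for $1\le i\le m$, then $VNM_1\dots M_m\Rightarrow_{int}V'N'M_1'\dots M_m'$. Strong parallel reduction: $M\Rrightarrow N$ iff $M\Rightarrow N$ and there exist terms $M',M''$ with $M\to_{h\beta_v}^*M'\to_{h\sigma}^*M''\Rightarrow_{int}N$. -}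

module Defs where

open import Data.Nat using (ℕ; zero; suc)
open import Data.Fin using (Fin; zero; suc)
open import Data.List using (List; []; _∷_)
open import Data.Product using (∃; ∃-syntax; _×_; _,_)
open import Relation.Binary.Construct.Closure.ReflexiveTransitive using (Star)

-- Terms of the call-by-value λ-calculus, up to α-conversion, as
-- well-scoped de Bruijn terms: Term n has free variables among Fin n.
-- Values are the subset  V ::= x | λx.M  (predicate IsValue).

data Term (n : ℕ) : Set where
  var : Fin n → Term n
  lam : Term (suc n) → Term n
  app : Term n → Term n → Term n

data IsValue {n : ℕ} : Term n → Set where
  v-var : (x : Fin n) → IsValue (var x)
  v-lam : (M : Term (suc n)) → IsValue (lam M)

infixl 5 _·*_
_·*_ : ∀ {n} → Term n → List (Term n) → Term n
M ·* []       = M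
M ·* (A ∷ As) = app M A ·* As

Ren : ℕ → ℕ → Set
Ren m n = Fin m → Fin n

extR : ∀ {m n} → Ren m n → Ren (suc m) (suc n)
extR ρ zero    = zero
extR ρ (suc i) = suc (ρ i)

rename : ∀ {m n} → Ren m n → Term m → Term n
rename ρ (var i)   = var (ρ i)
rename ρ (lam M)   = lam (rename (extR ρ) M)
rename ρ (app M N) = app (rename ρ M) (rename ρ N)

wk : ∀ {n} → Term n → Term (suc n)
wk = rename suc

Sub : ℕ → ℕ → Set
Sub m n = Fin m → Term n

extS : ∀ {m n} → Sub m n → Sub (suc m) (suc n)
extS σ zero    = var zero
extS σ (suc i) = wk (σ i)

subst : ∀ {m n} → Sub m n → Term m → Term n
subst σ (var i)   = σ i
subst σ (lam M)   = lam (subst (extS σ) M)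
subst σ (app M N) = app (subst σ M) (subst σ N)

-- M {V / x}, x being the variable bound by the enclosing λ (index 0)
_[_] : ∀ {n} → Term (suc n) → Term n → Term n
M [ V ] = subst σ M
  where
  σ : Sub _ _
  σ zero    = V
  σ (suc i) = var i

data _→hβv_ {n : ℕ} : Term n → Term n → Set where
  hβv-β   : ∀ (M : Term (suc n)) V Ms → IsValue V →
            (app (lam M) V ·* Ms) →hβv (M [ V ] ·* Ms)
  hβv-ctx : ∀ V {N N'} Ms → IsValue V → N →hβv N' →
            (app V N ·* Ms) →hβv (app V N' ·* Ms)

-- Head σ-reduction  (side conditions x ∉ fv(L), x ∉ fv(V) are realised
-- by weakening L resp. V under the binder)

data _→hσ_ {n : ℕ} : Term n → Term n → Set where
  hσ-1   : ∀ (M : Term (suc n)) N L Ms →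
           (app (app (lam M) N) L ·* Ms) →hσ (app (lam (app M (wk L))) N ·* Ms)
  hσ-3   : ∀ V (L : Term (suc n)) N Ms → IsValue V →
           (app V (app (lam L) N) ·* Ms) →hσ (app (lam (app (wk V) L)) N ·* Ms)
  hσ-ctx : ∀ V {N N'} Ms → IsValue V → N →hσ N' →
           (app V N ·* Ms) →hσ (app V N' ·* Ms)

mutual
  data _⇒_ {n : ℕ} : Term n → Term n → Set where
    p-βv  : ∀ {M₀ M₀' : Term (suc n)} {V V' Ms Ms'} →
            IsValue V → IsValue V' →
            V ⇒ V' → M₀ ⇒ M₀' → Ms ⇒ₗ Ms' →
            (app (lam M₀) V ·* Ms) ⇒ (M₀' [ V' ] ·* Ms')
    p-σ1  : ∀ {M₀ M₀' : Term (suc n)} {N N' L L' Ms Ms'} →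
            N ⇒ N' → L ⇒ L' → M₀ ⇒ M₀' → Ms ⇒ₗ Ms' →
            (app (app (lam M₀) N) L ·* Ms) ⇒ (app (lam (app M₀' (wk L'))) N' ·* Ms')
    p-σ3  : ∀ {V V' N N'} {L L' : Term (suc n)} {Ms Ms'} →
            IsValue V → IsValue V' →
            V ⇒ V' → N ⇒ N' → L ⇒ L' → Ms ⇒ₗ Ms' →
            (app V (app (lam L) N) ·* Ms) ⇒ (app (lam (app (wk V') L')) N' ·* Ms')
    p-lam : ∀ {M₀ M₀' : Term (suc n)} {Ms Ms'} →
            M₀ ⇒ M₀' → Ms ⇒ₗ Ms' →
            (lam M₀ ·* Ms) ⇒ (lam M₀' ·* Ms')
    p-var : ∀ (x : Fin n) {Ms Ms'} →
            Ms ⇒ₗ Ms' →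
            (var x ·* Ms) ⇒ (var x ·* Ms')

  data _⇒ₗ_ {n : ℕ} : List (Term n) → List (Term n) → Set where
    []  : [] ⇒ₗ []
    _∷_ : ∀ {M M' Ms Ms'} → M ⇒ M' → Ms ⇒ₗ Ms' → (M ∷ Ms) ⇒ₗ (M' ∷ Ms')

data _⇒int_ {n : ℕ} : Term n → Term n → Set where
  int-lam : ∀ {N N' : Term (suc n)} → N ⇒ N' → lam N ⇒int lam N'
  int-var : ∀ (x : Fin n) → var x ⇒int var x
  int-app : ∀ {V V' N N' Ms Ms'} → IsValue V → IsValue V' →
            V ⇒ V' → N ⇒int N' → Ms ⇒ₗ Ms' →
            (app V N ·* Ms) ⇒int (app V' N' ·* Ms')

_⇛_ : ∀ {n} → Term n → Term n → Set
M ⇛ N = M ⇒ N ×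
        ∃[ M' ] ∃[ M'' ] (Star _→hβv_ M M' × Star _→hσ_ M' M'' × M'' ⇒int N)

module Submission where

-- The parallel half (M N ⇒ M' N') holds because every rule of ⇒ concludes
-- at an application spine  H M₁ … Mₘ : one more argument is absorbed by
-- the spine of arguments.  The same observation shows that head βv- and
-- head σ-steps, as well as internal steps starting from a non-value, stay
-- valid when an argument is appended.
--
-- For the head-reduction half, let M →hβv* M₁ →hσ* M₂ ⇒int M'.
--  * If M₂ is a spine V X M₁ … Mₘ (not a value), then
--    M N →hβv* M₁ N →hσ* M₂ N ⇒int M' N'  using only N ⇒ N'.
--  * If M₂ is a value, the σ-sequence is empty (head σ-steps never produce
--    a value), so M N →hβv* M₂ N; the value M₂ now heads the term, so the
--    head reductions of N (N →hβv* N₁ →hσ* N₂ ⇒int N') happen in the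
--    argument position and  M N →hβv* M₂ N₁ →hσ* M₂ N₂ ⇒int M' N'.

open import Defs
open import Data.List using (List; []; _∷_; _++_)
open import Data.Product using (∃-syntax; _×_; _,_)
open import Data.Sum using (_⊎_; inj₁; inj₂)
open import Data.Empty using (⊥; ⊥-elim)
open import Relation.Binary.PropositionalEquality using (_≡_; refl; sym; subst₂)
open import Relation.Binary.Construct.Closure.ReflexiveTransitive
  using (Star; ε; _◅_; _◅◅_; gmap)

-- Standard-form head reduction: head βv-steps, then head σ-steps, then one
-- internal parallel step.  M ⇛ N is exactly  M ⇒ N × M ⇝ N.
_⇝_ : ∀ {n} → Term n → Term n → Set
M ⇝ N = ∃[ M₁ ] ∃[ M₂ ] (Star _→hβv_ M M₁ × Star _→hσ_ M₁ M₂ × M₂ ⇒int N)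

·*-snoc : ∀ {n} (H : Term n) Ms N → app (H ·* Ms) N ≡ H ·* (Ms ++ N ∷ [])
·*-snoc H []       N = refl
·*-snoc H (A ∷ Ms) N = ·*-snoc (app H A) Ms N

absorb : ∀ {n} (R : Term n → Term n → Set) H Ms N H' Ms' N' →
         R (H ·* (Ms ++ N ∷ [])) (H' ·* (Ms' ++ N' ∷ [])) →
         R (app (H ·* Ms) N) (app (H' ·* Ms') N')
absorb R H Ms N H' Ms' N' =
  subst₂ R (sym (·*-snoc H Ms N)) (sym (·*-snoc H' Ms' N'))

⇒ₗ-snoc : ∀ {n} {Ms Ms' : List (Term n)} {N N'} →
          Ms ⇒ₗ Ms' → N ⇒ N' → (Ms ++ N ∷ []) ⇒ₗ (Ms' ++ N' ∷ [])
⇒ₗ-snoc []       q = q ∷ []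
⇒ₗ-snoc (p ∷ ps) q = p ∷ ⇒ₗ-snoc ps q

⇒-app : ∀ {n} {M M' N N' : Term n} → M ⇒ M' → N ⇒ N' → app M N ⇒ app M' N'
⇒-app {N = N} {N'} (p-βv {M₀} {M₀'} {V} {V'} {Ms} {Ms'} v v' p p₀ ps) q =
  absorb _⇒_ (app (lam M₀) V) Ms N (M₀' [ V' ]) Ms' N'
    (p-βv v v' p p₀ (⇒ₗ-snoc ps q))
⇒-app {N = N} {N'} (p-σ1 {M₀} {M₀'} {A} {A'} {L} {L'} {Ms} {Ms'} pA pL p₀ ps) q =
  absorb _⇒_ (app (app (lam M₀) A) L) Ms N (app (lam (app M₀' (wk L'))) A') Ms' N'
    (p-σ1 pA pL p₀ (⇒ₗ-snoc ps q))
⇒-app {N = N} {N'} (p-σ3 {V} {V'} {A} {A'} {L} {L'} {Ms} {Ms'} v v' p pA pL ps) q =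
  absorb _⇒_ (app V (app (lam L) A)) Ms N (app (lam (app (wk V') L')) A') Ms' N'
    (p-σ3 v v' p pA pL (⇒ₗ-snoc ps q))
⇒-app {N = N} {N'} (p-lam {M₀} {M₀'} {Ms} {Ms'} p₀ ps) q =
  absorb _⇒_ (lam M₀) Ms N (lam M₀') Ms' N' (p-lam p₀ (⇒ₗ-snoc ps q))
⇒-app {N = N} {N'} (p-var x {Ms} {Ms'} ps) q =
  absorb _⇒_ (var x) Ms N (var x) Ms' N' (p-var x (⇒ₗ-snoc ps q))

→hβv-appˡ : ∀ {n} {M M' : Term n} N → M →hβv M' → app M N →hβv app M' N
→hβv-appˡ N (hβv-β M V Ms v) =
  absorb _→hβv_ (app (lam M) V) Ms N (M [ V ]) Ms N (hβv-β M V (Ms ++ N ∷ []) v)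
→hβv-appˡ N (hβv-ctx V {A} {A'} Ms v r) =
  absorb _→hβv_ (app V A) Ms N (app V A') Ms N (hβv-ctx V (Ms ++ N ∷ []) v r)

→hσ-appˡ : ∀ {n} {M M' : Term n} N → M →hσ M' → app M N →hσ app M' N
→hσ-appˡ N (hσ-1 M A L Ms) =
  absorb _→hσ_ (app (app (lam M) A) L) Ms N (app (lam (app M (wk L))) A) Ms N
    (hσ-1 M A L (Ms ++ N ∷ []))
→hσ-appˡ N (hσ-3 V L A Ms v) =
  absorb _→hσ_ (app V (app (lam L) A)) Ms N (app (lam (app (wk V) L)) A) Ms N
    (hσ-3 V L A (Ms ++ N ∷ []) v)
→hσ-appˡ N (hσ-ctx V {A} {A'} Ms v r) =
  absorb _→hσ_ (app V A) Ms N (app V A') Ms N (hσ-ctx V (Ms ++ N ∷ []) v r)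

spine-not-value : ∀ {n} (A B : Term n) Ms → IsValue (app A B ·* Ms) → ⊥
spine-not-value A B []       ()
spine-not-value A B (C ∷ Ms) v = spine-not-value (app A B) C Ms v

→hσ-not-value : ∀ {n} {M M' : Term n} → M →hσ M' → IsValue M' → ⊥
→hσ-not-value (hσ-1 M A L Ms)   v = spine-not-value (lam (app M (wk L))) A Ms v
→hσ-not-value (hσ-3 V L A Ms _) v = spine-not-value (lam (app (wk V) L)) A Ms v
→hσ-not-value (hσ-ctx V {N' = A'} Ms _ _) v = spine-not-value V A' Ms v

→hσ*-value : ∀ {n} {M V : Term n} → Star _→hσ_ M V → IsValue V → M ≡ V
→hσ*-value ε        v = refl
→hσ*-value (r ◅ rs) v with refl ← →hσ*-value rs v = ⊥-elim (→hσ-not-value r v)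

⇒int-value-or-app : ∀ {n} {M M' N N' : Term n} → M ⇒int M' → N ⇒ N' →
                    (IsValue M × IsValue M' × M ⇒ M') ⊎ (app M N ⇒int app M' N')
⇒int-value-or-app (int-lam {B} {B'} p) q = inj₁ (v-lam B , v-lam B' , p-lam p [])
⇒int-value-or-app (int-var x)          q = inj₁ (v-var x , v-var x , p-var x [])
⇒int-value-or-app {N = N} {N'} (int-app {V} {V'} {A} {A'} {Ms} {Ms'} v v' p i ps) q =
  inj₂ (absorb _⇒int_ (app V A) Ms N (app V' A') Ms' N' (int-app v v' p i (⇒ₗ-snoc ps q)))

⇝-under-value : ∀ {n} {V V' N N' : Term n} → IsValue V → IsValue V' → V ⇒ V' →
                N ⇝ N' → app V N ⇝ app V' N'
⇝-under-value {V = V} v v' p (N₁ , N₂ , βN , σN , iN) =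
  app V N₁ , app V N₂ ,
  gmap (app V) (hβv-ctx V [] v) βN ,
  gmap (app V) (hσ-ctx V [] v) σN ,
  int-app {Ms = []} {Ms' = []} v v' p iN []

→hβv*-appˡ : ∀ {n} {M M' : Term n} N → Star _→hβv_ M M' → Star _→hβv_ (app M N) (app M' N)
→hβv*-appˡ N = gmap (λ L → app L N) (→hβv-appˡ N)

→hσ*-appˡ : ∀ {n} {M M' : Term n} N → Star _→hσ_ M M' → Star _→hσ_ (app M N) (app M' N)
→hσ*-appˡ N = gmap (λ L → app L N) (→hσ-appˡ N)

-- Standard-form head reduction is compatible with application, given the
-- parallel step N ⇒ N' (spine case) and N ⇝ N' (value case).
⇝-app : ∀ {n} {M M' N N' : Term n} → M ⇝ M' → N ⇒ N' → N ⇝ N' → app M N ⇝ app M' N'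
⇝-app {N = N} (M₁ , M₂ , βM , σM , iM) pN ⇝N with ⇒int-value-or-app iM pN
... | inj₂ i = app M₁ N , app M₂ N , →hβv*-appˡ N βM , →hσ*-appˡ N σM , i
... | inj₁ (v , v' , p) with refl ← →hσ*-value σM v
                         with (N₁ , N₂ , βN , σN , iN) ← ⇝-under-value v v' p ⇝N =
  N₁ , N₂ , →hβv*-appˡ N βM ◅◅ βN , σN , iN

lemma3p13 : ∀ {n} (M M' N N' : Term n) → M ⇛ M' → N ⇛ N' → app M N ⇛ app M' N'
lemma3p13 M M' N N' (pM , ⇝M) (pN , ⇝N) = ⇒-app pM pN , ⇝-app ⇝M pN ⇝N
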